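{- For all integers $n,k$ with $1\le k\le n$, \[ r(n,k)=s(n,k)+s(n,k-1), \] where $r(n,k)=\frac{1}{n-k+1}\binom{2n-k}{k}\binom{2n-2k}{n-k}$ and $s(n,k)=\frac{1}{n+1}\binom{n-1}{k}\binom{2n-k}{n}$ (with $\binom{a}{b}=0$ for $b>a\ge 0$).
   Context: Combinatorially, $r(n,k)$ is the number of $2\times n$ arrays of positive integers with strictly increasing rows, weakly increasing columns, and set of entries exactly $\{1,\ldots,2n-k\}$; $s(n,k)$ is the number of such arrays whose columns are also strictly increasing. -}

module Defs where

open import Data.Nat using (ℕ; suc; _+_; _*_; _∸_)
open import Data.Nat.Combinatorics using (_C_)
open import Data.Integer using (+_)
open import Data.Rational using (ℚ; _/_)

-- r(n,k) = 1/(n-k+1) * C(2n-k,k) * C(2n-2k,n-k), as a rational number.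
-- (Intended for k ≤ n, where n ∸ k is true subtraction and suc (n ∸ k) = n-k+1.)
r : ℕ → ℕ → ℚ
r n k = + (((2 * n ∸ k) C k) * ((2 * n ∸ 2 * k) C (n ∸ k))) / suc (n ∸ k)

-- s(n,k) = 1/(n+1) * C(n-1,k) * C(2n-k,n), as a rational number.
-- (Intended for n ≥ 1 and k ≤ n, so all subtractions are true subtractions.)
-- Note: _C_ from the stdlib returns 0 when k > n, matching the paper's convention.
s : ℕ → ℕ → ℚ
s n k = + (((n ∸ 1) C k) * ((2 * n ∸ k) C n)) / suc n

-- Put n = k + m and A = C(n+m, k) C(2m, m), the trinomial coefficient (k+2m)!/(k! m! m!),
-- which is the numerator of r(n,k) = A/(m+1).  The absorption identities for binomial
-- coefficients give n C(n-1,k) C(2n-k,n) = m A and n (m+1) C(n-1,k-1) C(2n-k+1,n) = k (2n-k+1) A,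
-- so after clearing denominators the theorem reduces to m (m+1) + k (n+m+1) = n (n+1).

module Submission where

open import Data.Nat using (ℕ; zero; suc; _+_; _*_; _∸_; _≤_; _!; z≤n; s≤s; NonZero)
open import Data.Nat.Properties
open import Data.Nat.Combinatorics using (_C_; nCk≡n!/k![n-k]!; k![n∸k]!∣n!; k>n⇒nCk≡0)
open import Data.Nat.DivMod using (_/_; m/n*n≡m)
open import Data.Nat.Tactic.RingSolver using (solve-∀)
open import Data.Integer as ℤ using (+_)
open import Data.Integer.Properties using (pos-+; pos-*)
open import Data.Rational as ℚ using (ℚ; toℚᵘ)
open import Data.Rational.Properties using (toℚᵘ-injective; toℚᵘ-fromℚᵘ; toℚᵘ-homo-+)
open import Data.Rational.Unnormalised as ℚᵘ using (mkℚᵘ; *≡*)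
open import Data.Rational.Unnormalised.Properties using (+-cong; module ≃-Reasoning)
open import Relation.Binary.PropositionalEquality
open import Algebra.Properties.CommutativeSemigroup *-commutativeSemigroup using (x∙yz≈yx∙z; xy∙z≈x∙zy)

open import Defs

m+n≡o⇒oCm*[m!*n!]≡o! : ∀ m n {o} → m + n ≡ o → (o C m) * (m ! * n !) ≡ o !
m+n≡o⇒oCm*[m!*n!]≡o! m n refl = begin
  ((m + n) C m) * (m ! * n !) ≡⟨ cong (λ j → ((m + n) C m) * (m ! * j !)) (m+n∸m≡n m n) ⟨
  ((m + n) C m) * d           ≡⟨ cong (_* d) (nCk≡n!/k![n-k]! (m≤m+n m n)) ⟩
  (m + n) ! / d * d           ≡⟨ m/n*n≡m (k![n∸k]!∣n! (m≤m+n m n)) ⟩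
  (m + n) !                   ∎
  where
  open ≡-Reasoning
  d = m ! * (m + n ∸ m) !
  instance _ = m !* (m + n ∸ m) !≢0

equal-multiples⇒≡ : ∀ {x y z} d .{{_ : NonZero d}} → x * d ≡ z → y * d ≡ z → x ≡ y
equal-multiples⇒≡ d xd≡z yd≡z = *-cancelʳ-≡ _ _ d (trans xd≡z (sym yd≡z))

[1+m+n]*[m+n]Cm*[m!*n!]≡[1+m+n]! : ∀ m n → suc (m + n) * ((m + n) C m) * (m ! * n !) ≡ suc (m + n) !
[1+m+n]*[m+n]Cm*[m!*n!]≡[1+m+n]! m n =
  trans (*-assoc (suc (m + n)) ((m + n) C m) (m ! * n !))
        (cong (suc (m + n) *_) (m+n≡o⇒oCm*[m!*n!]≡o! m n refl))

[1+m+n]C[1+m]*[1+m]≡[1+m+n]*[m+n]Cm : ∀ m n → (suc (m + n) C suc m) * suc m ≡ suc (m + n) * ((m + n) C m)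
[1+m+n]C[1+m]*[1+m]≡[1+m+n]*[m+n]Cm m n =
  equal-multiples⇒≡ (m ! * n !) {{m !* n !≢0}} lhs ([1+m+n]*[m+n]Cm*[m!*n!]≡[1+m+n]! m n)
  where
  xy∙zw≈x∙yz∙w : ∀ x y z w → x * y * (z * w) ≡ x * (y * z * w)
  xy∙zw≈x∙yz∙w = solve-∀
  lhs : (suc (m + n) C suc m) * suc m * (m ! * n !) ≡ suc (m + n) !
  lhs = trans (xy∙zw≈x∙yz∙w (suc (m + n) C suc m) (suc m) (m !) (n !))
              (m+n≡o⇒oCm*[m!*n!]≡o! (suc m) n refl)

[1+m+n]Cm*[1+n]≡[1+m+n]*[m+n]Cm : ∀ m n → (suc (m + n) C m) * suc n ≡ suc (m + n) * ((m + n) C m)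
[1+m+n]Cm*[1+n]≡[1+m+n]*[m+n]Cm m n =
  equal-multiples⇒≡ (m ! * n !) {{m !* n !≢0}} lhs ([1+m+n]*[m+n]Cm*[m!*n!]≡[1+m+n]! m n)
  where
  xy∙zw≈x∙z∙yw : ∀ x y z w → x * y * (z * w) ≡ x * (z * (y * w))
  xy∙zw≈x∙z∙yw = solve-∀
  lhs : (suc (m + n) C m) * suc n * (m ! * n !) ≡ suc (m + n) !
  lhs = trans (xy∙zw≈x∙z∙yw (suc (m + n) C m) (suc n) (m !) (n !))
              (m+n≡o⇒oCm*[m!*n!]≡o! m (suc n) (+-suc m n))

[m+n]C[1+m]*[1+m+n]≡n*[1+m+n]C[1+m] : ∀ m n → ((m + n) C suc m) * suc (m + n) ≡ n * (suc (m + n) C suc m)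
[m+n]C[1+m]*[1+m+n]≡n*[1+m+n]C[1+m] m zero =
  cong (_* suc (m + 0)) (k>n⇒nCk≡0 (s≤s (≤-reflexive (+-identityʳ m))))
[m+n]C[1+m]*[1+m+n]≡n*[1+m+n]C[1+m] m (suc n) = begin
  ((m + suc n) C suc m) * suc (m + suc n)   ≡⟨ cong (λ j → (j C suc m) * suc j) (+-suc m n) ⟩
  ((suc m + n) C suc m) * suc (suc m + n)   ≡⟨ *-comm ((suc m + n) C suc m) (suc (suc m + n)) ⟩
  suc (suc m + n) * ((suc m + n) C suc m)   ≡⟨ [1+m+n]Cm*[1+n]≡[1+m+n]*[m+n]Cm (suc m) n ⟨
  (suc (suc m + n) C suc m) * suc n         ≡⟨ *-comm (suc (suc m + n) C suc m) (suc n) ⟩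
  suc n * (suc (suc m + n) C suc m)         ≡⟨ cong (λ j → suc n * (suc j C suc m)) (+-suc m n) ⟨
  suc n * (suc (m + suc n) C suc m)         ∎
  where open ≡-Reasoning

[m+n+o]C[m+n]*[m+n]Cm≡[m+n+o]Cm*[n+o]Cn : ∀ m n o →
  ((m + n + o) C (m + n)) * ((m + n) C m) ≡ ((m + n + o) C m) * ((n + o) C n)
[m+n+o]C[m+n]*[m+n]Cm≡[m+n+o]Cm*[n+o]Cn m n o =
  equal-multiples⇒≡ (m ! * n ! * o !) {{m*n≢0 (m ! * n !) (o !) {{m !* n !≢0}} {{o !≢0}}}} lhs rhs
  where
  open ≡-Reasoning
  ab∙xyz≈a∙bxy∙z : ∀ a b x y z → a * b * (x * y * z) ≡ a * (b * (x * y) * z)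
  ab∙xyz≈a∙bxy∙z = solve-∀
  ab∙xyz≈a∙x∙byz : ∀ a b x y z → a * b * (x * y * z) ≡ a * (x * (b * (y * z)))
  ab∙xyz≈a∙x∙byz = solve-∀
  lhs : ((m + n + o) C (m + n)) * ((m + n) C m) * (m ! * n ! * o !) ≡ (m + n + o) !
  lhs = begin
    ((m + n + o) C (m + n)) * ((m + n) C m) * (m ! * n ! * o !)
      ≡⟨ ab∙xyz≈a∙bxy∙z ((m + n + o) C (m + n)) ((m + n) C m) (m !) (n !) (o !) ⟩
    ((m + n + o) C (m + n)) * (((m + n) C m) * (m ! * n !) * o !)
      ≡⟨ cong (λ x → ((m + n + o) C (m + n)) * (x * o !)) (m+n≡o⇒oCm*[m!*n!]≡o! m n refl) ⟩
    ((m + n + o) C (m + n)) * ((m + n) ! * o !)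
      ≡⟨ m+n≡o⇒oCm*[m!*n!]≡o! (m + n) o refl ⟩
    (m + n + o) !
      ∎
  rhs : ((m + n + o) C m) * ((n + o) C n) * (m ! * n ! * o !) ≡ (m + n + o) !
  rhs = begin
    ((m + n + o) C m) * ((n + o) C n) * (m ! * n ! * o !)
      ≡⟨ ab∙xyz≈a∙x∙byz ((m + n + o) C m) ((n + o) C n) (m !) (n !) (o !) ⟩
    ((m + n + o) C m) * (m ! * (((n + o) C n) * (n ! * o !)))
      ≡⟨ cong (λ x → ((m + n + o) C m) * (m ! * x)) (m+n≡o⇒oCm*[m!*n!]≡o! n o refl) ⟩
    ((m + n + o) C m) * (m ! * (n + o) !)
      ≡⟨ m+n≡o⇒oCm*[m!*n!]≡o! m (n + o) (sym (+-assoc m n o)) ⟩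
    (m + n + o) !
      ∎

ratio : ℕ → ℕ → ℚ
ratio a d = + a ℚ./ suc d

ratio-+ : ∀ a q c e d → a * suc d ≡ suc q * (c + e) → ratio a q ≡ ratio c d ℚ.+ ratio e d
ratio-+ a q c e d a[1+d]≡[1+q][c+e] = toℚᵘ-injective (begin
  toℚᵘ (ratio a q)                        ≈⟨ toℚᵘ-fromℚᵘ (mkℚᵘ (+ a) q) ⟩
  mkℚᵘ (+ a) q                            ≈⟨ *≡* cross-multiplied ⟩
  mkℚᵘ (+ c) d ℚᵘ.+ mkℚᵘ (+ e) d
    ≈⟨ +-cong (toℚᵘ-fromℚᵘ (mkℚᵘ (+ c) d)) (toℚᵘ-fromℚᵘ (mkℚᵘ (+ e) d)) ⟨
  toℚᵘ (ratio c d) ℚᵘ.+ toℚᵘ (ratio e d)  ≈⟨ toℚᵘ-homo-+ (ratio c d) (ratio e d) ⟨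
  toℚᵘ (ratio c d ℚ.+ ratio e d)          ∎)
  where
  open ≃-Reasoning
  distribute : ∀ q c e s → q * (c + e) * s ≡ (c * s + e * s) * q
  distribute = solve-∀
  cross-multiplied : + a ℤ.* + (suc d * suc d) ≡ (+ c ℤ.* + suc d ℤ.+ + e ℤ.* + suc d) ℤ.* + suc q
  cross-multiplied = Eq.begin
    + a ℤ.* + (suc d * suc d)              Eq.≡⟨ pos-* a (suc d * suc d) ⟨
    + (a * (suc d * suc d))                Eq.≡⟨ cong +_ natural-cross-multiplied ⟩
    + ((c * suc d + e * suc d) * suc q)    Eq.≡⟨ pos-* (c * suc d + e * suc d) (suc q) ⟩
    + (c * suc d + e * suc d) ℤ.* + suc q  Eq.≡⟨ cong (ℤ._* + suc q) (pos-+ (c * suc d) (e * suc d)) ⟩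
    (+ (c * suc d) ℤ.+ + (e * suc d)) ℤ.* + suc q
      Eq.≡⟨ cong₂ (λ x y → (x ℤ.+ y) ℤ.* + suc q) (pos-* c (suc d)) (pos-* e (suc d)) ⟩
    (+ c ℤ.* + suc d ℤ.+ + e ℤ.* + suc d) ℤ.* + suc q Eq.∎
    where
    module Eq = ≡-Reasoning
    natural-cross-multiplied : a * (suc d * suc d) ≡ (c * suc d + e * suc d) * suc q
    natural-cross-multiplied = Eq.begin
      a * (suc d * suc d)               Eq.≡⟨ *-assoc a (suc d) (suc d) ⟨
      a * suc d * suc d                 Eq.≡⟨ cong (_* suc d) a[1+d]≡[1+q][c+e] ⟩
      suc q * (c + e) * suc d           Eq.≡⟨ distribute (suc q) c e (suc d) ⟩
      (c * suc d + e * suc d) * suc q   Eq.∎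

2*[k+m]∸k≡k+m+m : ∀ k m → 2 * (k + m) ∸ k ≡ k + m + m
2*[k+m]∸k≡k+m+m k m = trans (cong (_∸ k) (double k m)) (m+n∸m≡n k (k + m + m))
  where
  double : ∀ k m → 2 * (k + m) ≡ k + (k + m + m)
  double = solve-∀

2*[k+m]∸2*k≡m+m : ∀ k m → 2 * (k + m) ∸ 2 * k ≡ m + m
2*[k+m]∸2*k≡m+m k m = trans (cong (_∸ 2 * k) (double k m)) (m+n∸m≡n (2 * k) (m + m))
  where
  double : ∀ k m → 2 * (k + m) ≡ 2 * k + (m + m)
  double = solve-∀

2*[1+k+m]∸k≡1+[1+k+m+m] : ∀ k m → 2 * (suc k + m) ∸ k ≡ suc (suc k + m + m)
2*[1+k+m]∸k≡1+[1+k+m+m] k m = trans (cong (_∸ k) (double k m)) (m+n∸m≡n k (suc (suc k + m + m)))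
  where
  double : ∀ k m → 2 * (suc k + m) ≡ k + suc (suc k + m + m)
  double = solve-∀

r-closed-form : ∀ k m → r (k + m) k ≡ ratio (((k + m + m) C k) * ((m + m) C m)) m
r-closed-form k m = cong₂ ratio
  (cong₂ _*_ (cong (_C k) (2*[k+m]∸k≡k+m+m k m)) (cong₂ _C_ (2*[k+m]∸2*k≡m+m k m) (m+n∸m≡n k m)))
  (m+n∸m≡n k m)

s-closed-form : ∀ k m → let n = suc k + m in
  s n (suc k) ≡ ratio (((k + m) C suc k) * ((n + m) C n)) n
s-closed-form k m =
  cong (λ j → ratio (((k + m) C suc k) * (j C (suc k + m))) (suc k + m)) (2*[k+m]∸k≡k+m+m (suc k) m)

s-pred-closed-form : ∀ k m → let n = suc k + m in
  s n k ≡ ratio (((k + m) C k) * (suc (n + m) C n)) n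
s-pred-closed-form k m =
  cong (λ j → ratio (((k + m) C k) * (j C (suc k + m))) (suc k + m)) (2*[1+k+m]∸k≡1+[1+k+m+m] k m)

r≡s+s-pred-cross-multiplied : ∀ k m → let n = suc k + m in
  ((n + m) C suc k) * ((m + m) C m) * suc n
    ≡ suc m * (((k + m) C suc k) * ((n + m) C n) + ((k + m) C k) * (suc (n + m) C n))
r≡s+s-pred-cross-multiplied k m = *-cancelˡ-≡ (A * suc n) (suc m * (X + Y)) n (sym (begin
  n * (suc m * (X + Y))              ≡⟨ distribute n (suc m) X Y ⟩
  suc m * (n * X) + n * Y * suc m    ≡⟨ cong₂ (λ u v → suc m * u + v) nX≡mA nY[1+m]≡[1+k][1+n+m]A ⟩
  suc m * (m * A) + suc k * suc (n + m) * A ≡⟨ collect k m A ⟩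
  n * (A * suc n)                    ∎))
  where
  open ≡-Reasoning
  n = suc k + m
  P = n C suc k
  T = (n + m) C n
  A = ((n + m) C suc k) * ((m + m) C m)
  X = ((k + m) C suc k) * T
  Y = ((k + m) C k) * (suc (n + m) C n)

  distribute : ∀ n s x y → n * (s * (x + y)) ≡ s * (n * x) + n * y * s
  distribute = solve-∀
  collect : ∀ k m a →
    suc m * (m * a) + suc k * suc (suc k + m + m) * a ≡ (suc k + m) * (a * suc (suc k + m))
  collect = solve-∀
  x∙yz∙w≈xy∙zw : ∀ x y z w → x * (y * z) * w ≡ x * y * (z * w)
  x∙yz∙w≈xy∙zw = solve-∀
  xy∙zw≈yz∙wx : ∀ x y z w → x * y * (z * w) ≡ y * z * (w * x)
  xy∙zw≈yz∙wx = solve-∀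

  TP≡A : T * P ≡ A
  TP≡A = [m+n+o]C[m+n]*[m+n]Cm≡[m+n+o]Cm*[n+o]Cn (suc k) m m

  nX≡mA : n * X ≡ m * A
  nX≡mA = begin
    n * X                               ≡⟨ x∙yz≈yx∙z n ((k + m) C suc k) T ⟩
    ((k + m) C suc k) * n * T           ≡⟨ cong (_* T) ([m+n]C[1+m]*[1+m+n]≡n*[1+m+n]C[1+m] k m) ⟩
    m * P * T                           ≡⟨ xy∙z≈x∙zy m P T ⟩
    m * (T * P)                         ≡⟨ cong (m *_) TP≡A ⟩
    m * A                               ∎

  nY[1+m]≡[1+k][1+n+m]A : n * Y * suc m ≡ suc k * suc (n + m) * A
  nY[1+m]≡[1+k][1+n+m]A = begin
    n * Y * suc m
      ≡⟨ x∙yz∙w≈xy∙zw n ((k + m) C k) (suc (n + m) C n) (suc m) ⟩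
    n * ((k + m) C k) * ((suc (n + m) C n) * suc m)
      ≡⟨ cong₂ _*_ (sym ([1+m+n]C[1+m]*[1+m]≡[1+m+n]*[m+n]Cm k m)) ([1+m+n]Cm*[1+n]≡[1+m+n]*[m+n]Cm n m) ⟩
    P * suc k * (suc (n + m) * T)
      ≡⟨ xy∙zw≈yz∙wx P (suc k) (suc (n + m)) T ⟩
    suc k * suc (n + m) * (T * P)
      ≡⟨ cong (suc k * suc (n + m) *_) TP≡A ⟩
    suc k * suc (n + m) * A
      ∎

r≡s+s-pred : ∀ k m → let n = suc k + m in r n (suc k) ≡ s n (suc k) ℚ.+ s n k
r≡s+s-pred k m = begin
  r n (suc k)                ≡⟨ r-closed-form (suc k) m ⟩
  ratio A m                  ≡⟨ ratio-+ A m X Y n (r≡s+s-pred-cross-multiplied k m) ⟩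
  ratio X n ℚ.+ ratio Y n    ≡⟨ cong₂ ℚ._+_ (s-closed-form k m) (s-pred-closed-form k m) ⟨
  s n (suc k) ℚ.+ s n k      ∎
  where
  open ≡-Reasoning
  n = suc k + m
  A = ((n + m) C suc k) * ((m + m) C m)
  X = ((k + m) C suc k) * ((n + m) C n)
  Y = ((k + m) C k) * (suc (n + m) C n)

theorem2p1 : (n k : ℕ) → 1 ≤ k → k ≤ n → r n k ≡ s n k ℚ.+ s n (k ∸ 1)
theorem2p1 n (suc k) (s≤s z≤n) 1+k≤n =
  subst (λ n → r n (suc k) ≡ s n (suc k) ℚ.+ s n k) (m+[n∸m]≡n 1+k≤n) (r≡s+s-pred k (n ∸ suc k))
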